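{- Let $n\ge1$. If $m\ge2$ and $C_n(i)=3^m$ is a strict local maximum of $C_n$, then $i=3j+1$ for some $j$ such that $C_{n-1}(j)=3^{m-1}$ is a strict local maximum of $C_{n-1}$. If $C_n(i)=3$ is a strict local maximum of $C_n$, then $i=3j+1$ for some $j$ with $C_{n-1}(j)=1$.
   Context: The unit weight-$3$ Stern–Brocot sequences $SB_n$ ($n\ge0$): $SB_0=(\frac{0}{1},\frac{1}{1})$, and $SB_{n+1}$ is obtained from $SB_n$ by keeping all its terms in order and inserting, between each pair of consecutive terms $\frac{p}{q},\frac{r}{s}$ (in lowest terms, positive denominators), the two fractions $\frac{2p+r}{2q+s}$ and $\frac{p+2r}{q+2s}$, each reduced to lowest terms, in this order. $SB_n$ has $3^n+1$ terms, indexed from $0$. For $0\le i<3^n$, $C_n(i)=qr-ps$ where $\frac{p}{q}$ and $\frac{r}{s}$ are the $i$-th and $(i+1)$-th terms of $SB_n$ in lowest terms with positive denominators. $C_n(i)$ is a strict local maximum (a peak) if $C_n(i)>C_n(j)$ for each $j\in\{i-1,i+1\}$ with $0\le j<3^n$. -}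

module Defs where

open import Data.Nat as ℕ using (ℕ; zero; suc; _^_)
open import Data.Integer as ℤ using (ℤ; +_)
open import Data.Rational using (ℚ; _/_; ↥_; ↧_; ↧ₙ_; 0ℚ; 1ℚ)
open import Data.List using (List; []; _∷_)
open import Data.Product using (_×_)
open import Data.Sum using (_⊎_)
open import Relation.Binary.PropositionalEquality using (_≡_)

-- Terms of the sequences are rationals in lowest terms (ℚ of the stdlib is
-- always normalised, with positive denominator).

med₁ : ℚ → ℚ → ℚ
med₁ x y = (ℤ.+ 2 ℤ.* (↥ x) ℤ.+ (↥ y)) / (2 ℕ.* (↧ₙ x) ℕ.+ (↧ₙ y))

med₂ : ℚ → ℚ → ℚ
med₂ x y = ((↥ x) ℤ.+ ℤ.+ 2 ℤ.* (↥ y)) / ((↧ₙ x) ℕ.+ 2 ℕ.* (↧ₙ y))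

step : List ℚ → List ℚ
step (x ∷ y ∷ rest) = x ∷ med₁ x y ∷ med₂ x y ∷ step (y ∷ rest)
step l = l

SB : ℕ → List ℚ
SB zero = 0ℚ ∷ 1ℚ ∷ []
SB (suc n) = step (SB n)

-- i-th element (0-indexed), default 0 out of range (only used in range)
nth : List ℚ → ℕ → ℚ
nth [] _ = 0ℚ
nth (x ∷ _) zero = x
nth (_ ∷ xs) (suc i) = nth xs i

C : ℕ → ℕ → ℤ
C n i = (↧ x) ℤ.* (↥ y) ℤ.- (↥ x) ℤ.* (↧ y)
  where
  x = nth (SB n) i
  y = nth (SB n) (suc i)

IsPeak : ℕ → ℕ → Set
IsPeak n i = (i ℕ.< 3 ^ n) ×
  (∀ j → j ℕ.< 3 ^ n → (suc j ≡ i ⊎ j ≡ suc i) → C n j ℤ.< C n i)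

-- Read each term p/q of SB k as the primitive vector (p , q) ∈ ℤ², so that C is the determinant
-- of consecutive terms. Every gap (x , y) of SB k has, for some t with det (x , t) = 1, either
-- y = x + 3^e t with e ≥ 1 (a translation) or y = 3^e t - x (a reflection); either way C = 3^e.
-- Both mediants of a translation are divisible by 3, and its three children are translations by
-- 3^(e-1) t, so C is flat there. The mediants of a reflection are already primitive: its children
-- are x + 3^e t, then the reflection of that by 3^(e+1) t, then a translation back to y, so C takes
-- the values 3^e, 3^(e+1), 3^e. Hence every peak of C (k+1) is the middle child of a reflection,
-- with three times the parent value, and a reflection of positive exponent is itself such a middle
-- child, hence a peak.

module Submission where

open import Defs
open import Data.Nat using (ℕ; zero; suc; NonZero; _^_; _*_; _+_; _∸_; _≤_; _<_; z≤n; s≤s)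
import Data.Nat.Properties as ℕ
open import Data.Nat.Divisibility using (∣-antisym)
open import Data.Integer as ℤ using (ℤ; +_; 1ℤ)
import Data.Integer.Properties as ℤ
import Data.Integer.Divisibility.Signed as ℤ
open import Data.Integer.GCD using (gcd; gcd[i,j]∣i; gcd[i,j]∣j; gcd-greatest)
open import Data.Integer.Tactic.RingSolver using (solve-∀)
open import Data.Rational using (ℚ; _/_; ↥_; ↧_; ↧ₙ_)
open import Data.Rational.Properties using (↥-/; ↧-/)
open import Data.List using (List; []; _∷_; length)
open import Data.Product using (_×_; _,_; proj₁; proj₂; ∃-syntax)
open import Data.Sum using (_⊎_; inj₁; inj₂)
open import Data.Unit using (⊤; tt)
open import Data.Empty using (⊥-elim)
open import Function using (_∘_)
open import Relation.Binary.PropositionalEquality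

ℤ² : Set
ℤ² = ℤ × ℤ

-- C n i is definitionally det ⟦ x ⟧ ⟦ y ⟧ for the terms x, y of SB n at i and suc i.
⟦_⟧ : ℚ → ℤ²
⟦ x ⟧ = ↥ x , ↧ x

infixl 6 _⊕_ _⊖_
infixr 7 _·_

_⊕_ _⊖_ : ℤ² → ℤ² → ℤ²
(p , q) ⊕ (r , s) = p ℤ.+ r , q ℤ.+ s
(p , q) ⊖ (r , s) = p ℤ.- r , q ℤ.- s

_·_ : ℤ → ℤ² → ℤ²
c · (p , q) = c ℤ.* p , c ℤ.* q

⊝_ : ℤ² → ℤ²
⊝ (p , q) = ℤ.- p , ℤ.- q

det : ℤ² → ℤ² → ℤ
det (p , q) (r , s) = q ℤ.* r ℤ.- p ℤ.* s

det-translateʳ : ∀ u t c → det u (u ⊕ c · t) ≡ c ℤ.* det u t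
det-translateʳ (p , q) (τ , σ) c = identity p q τ σ c
  where
  identity : ∀ p q τ σ c →
    q ℤ.* (p ℤ.+ c ℤ.* τ) ℤ.- p ℤ.* (q ℤ.+ c ℤ.* σ) ≡ c ℤ.* (q ℤ.* τ ℤ.- p ℤ.* σ)
  identity = solve-∀

det-reflectʳ : ∀ u t c → det u (c · t ⊖ u) ≡ c ℤ.* det u t
det-reflectʳ (p , q) (τ , σ) c = identity p q τ σ c
  where
  identity : ∀ p q τ σ c →
    q ℤ.* (c ℤ.* τ ℤ.- p) ℤ.- p ℤ.* (c ℤ.* σ ℤ.- q) ≡ c ℤ.* (q ℤ.* τ ℤ.- p ℤ.* σ)
  identity = solve-∀

det-translateˡ : ∀ u t c → det (u ⊕ c · t) t ≡ det u t
det-translateˡ (p , q) (τ , σ) c = identity p q τ σ c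
  where
  identity : ∀ p q τ σ c →
    (q ℤ.+ c ℤ.* σ) ℤ.* τ ℤ.- (p ℤ.+ c ℤ.* τ) ℤ.* σ ≡ q ℤ.* τ ℤ.- p ℤ.* σ
  identity = solve-∀

det-reflectˡ : ∀ u t c → det (c · t ⊖ u) (⊝ t) ≡ det u t
det-reflectˡ (p , q) (τ , σ) c = identity p q τ σ c
  where
  identity : ∀ p q τ σ c →
    (c ℤ.* σ ℤ.- q) ℤ.* (ℤ.- τ) ℤ.- (c ℤ.* τ ℤ.- p) ℤ.* (ℤ.- σ) ≡ q ℤ.* τ ℤ.- p ℤ.* σ
  identity = solve-∀

module _ {u t : ℤ²} (unimodular : det u t ≡ 1ℤ) where

  private
    scaled : ∀ c → c ℤ.* det u t ≡ c
    scaled c = trans (cong (c ℤ.*_) unimodular) (ℤ.*-identityʳ c)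

  det-translation : ∀ {c v} → v ≡ u ⊕ c · t → det u v ≡ c
  det-translation {c} refl = trans (det-translateʳ u t c) (scaled c)

  det-reflection : ∀ {c v} → v ≡ c · t ⊖ u → det u v ≡ c
  det-reflection {c} refl = trans (det-reflectʳ u t c) (scaled c)

  translation-unimodular : ∀ {c v} → v ≡ u ⊕ c · t → det v t ≡ 1ℤ
  translation-unimodular {c} refl = trans (det-translateˡ u t c) unimodular

  reflection-unimodular : ∀ {c v} → v ≡ c · t ⊖ u → det v (⊝ t) ≡ 1ℤ
  reflection-unimodular {c} refl = trans (det-reflectˡ u t c) unimodular

-- A unimodular partner t of w is a Bézout certificate: it shows gcd (k w₁) (k w₂) = k.
⟦/⟧≡primitive : ∀ i n .{{_ : NonZero n}} k .{{_ : NonZero k}} w t →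
                (i , + n) ≡ + k · w → det w t ≡ 1ℤ → ⟦ i / n ⟧ ≡ w
⟦/⟧≡primitive i n k (w₁ , w₂) (t₁ , t₂) i,n≡k·w unimodular =
  cong₂ _,_ (cancel (↥-/ i n) i≡k*w₁) (cancel (↧-/ i n) n≡k*w₂)
  where
  open ≡-Reasoning
  i≡k*w₁ : i ≡ + k ℤ.* w₁
  i≡k*w₁ = cong proj₁ i,n≡k·w
  n≡k*w₂ : + n ≡ + k ℤ.* w₂
  n≡k*w₂ = cong proj₂ i,n≡k·w

  bézout : + n ℤ.* t₁ ℤ.- i ℤ.* t₂ ≡ + k
  bézout = begin
    + n ℤ.* t₁ ℤ.- i ℤ.* t₂                  ≡⟨ cong₂ (λ m j → m ℤ.* t₁ ℤ.- j ℤ.* t₂) n≡k*w₂ i≡k*w₁ ⟩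
    + k ℤ.* w₂ ℤ.* t₁ ℤ.- + k ℤ.* w₁ ℤ.* t₂  ≡⟨ factor (+ k) w₁ w₂ t₁ t₂ ⟩
    + k ℤ.* det (w₁ , w₂) (t₁ , t₂)          ≡⟨ cong (+ k ℤ.*_) unimodular ⟩
    + k ℤ.* 1ℤ                               ≡⟨ ℤ.*-identityʳ (+ k) ⟩
    + k                                      ∎
    where
    factor : ∀ k w₁ w₂ t₁ t₂ →
      k ℤ.* w₂ ℤ.* t₁ ℤ.- k ℤ.* w₁ ℤ.* t₂ ≡ k ℤ.* (w₂ ℤ.* t₁ ℤ.- w₁ ℤ.* t₂)
    factor = solve-∀

  gcd∣k : gcd i (+ n) ℤ.∣ + k
  gcd∣k = subst (gcd i (+ n) ℤ.∣_) bézout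
    (ℤ.∣m∣n⇒∣m-n (ℤ.∣m⇒∣m*n t₁ gcd∣n) (ℤ.∣m⇒∣m*n t₂ gcd∣i))
    where
    gcd∣i : gcd i (+ n) ℤ.∣ i
    gcd∣i = ℤ.∣ᵤ⇒∣ (gcd[i,j]∣i i (+ n))
    gcd∣n : gcd i (+ n) ℤ.∣ + n
    gcd∣n = ℤ.∣ᵤ⇒∣ (gcd[i,j]∣j i (+ n))

  gcd≡k : gcd i (+ n) ≡ + k
  gcd≡k = cong +_ (∣-antisym (ℤ.∣⇒∣ᵤ {gcd i (+ n)} gcd∣k)
                             (gcd-greatest {i} {+ n} {+ k} (ℤ.∣⇒∣ᵤ k∣i) (ℤ.∣⇒∣ᵤ k∣n)))
    where
    k∣i : + k ℤ.∣ i
    k∣i = ℤ.divides w₁ (trans i≡k*w₁ (ℤ.*-comm (+ k) w₁))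
    k∣n : + k ℤ.∣ + n
    k∣n = ℤ.divides w₂ (trans n≡k*w₂ (ℤ.*-comm (+ k) w₂))

  cancel : ∀ {z m w} → z ℤ.* gcd i (+ n) ≡ m → m ≡ + k ℤ.* w → z ≡ w
  cancel {z} {m} {w} z*gcd≡m m≡k*w = ℤ.*-cancelʳ-≡ z w (+ k) (begin
    z ℤ.* + k           ≡⟨ cong (z ℤ.*_) gcd≡k ⟨
    z ℤ.* gcd i (+ n)   ≡⟨ z*gcd≡m ⟩
    m                   ≡⟨ m≡k*w ⟩
    + k ℤ.* w           ≡⟨ ℤ.*-comm (+ k) w ⟩
    w ℤ.* + k           ∎)

⟦med₁⟧≡ : ∀ x y k .{{_ : NonZero k}} w t →
          + 2 · ⟦ x ⟧ ⊕ ⟦ y ⟧ ≡ + k · w → det w t ≡ 1ℤ → ⟦ med₁ x y ⟧ ≡ w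
⟦med₁⟧≡ x y k w t eq =
  ⟦/⟧≡primitive (+ 2 ℤ.* ↥ x ℤ.+ ↥ y) (2 * ↧ₙ x + ↧ₙ y) k w t
    (trans (cong (+ 2 ℤ.* ↥ x ℤ.+ ↥ y ,_) denominator) eq)
  where
  denominator : + (2 * ↧ₙ x + ↧ₙ y) ≡ + 2 ℤ.* ↧ x ℤ.+ ↧ y
  denominator = trans (ℤ.pos-+ (2 * ↧ₙ x) (↧ₙ y)) (cong (ℤ._+ ↧ y) (ℤ.pos-* 2 (↧ₙ x)))

⟦med₂⟧≡ : ∀ x y k .{{_ : NonZero k}} w t →
          ⟦ x ⟧ ⊕ + 2 · ⟦ y ⟧ ≡ + k · w → det w t ≡ 1ℤ → ⟦ med₂ x y ⟧ ≡ w
⟦med₂⟧≡ x y k w t eq =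
  ⟦/⟧≡primitive (↥ x ℤ.+ + 2 ℤ.* ↥ y) (↧ₙ x + 2 * ↧ₙ y) k w t
    (trans (cong (↥ x ℤ.+ + 2 ℤ.* ↥ y ,_) denominator) eq)
  where
  denominator : + (↧ₙ x + 2 * ↧ₙ y) ≡ ↧ x ℤ.+ + 2 ℤ.* ↧ y
  denominator = trans (ℤ.pos-+ (↧ₙ x) (2 * ↧ₙ y)) (cong (ℤ._+_ (↧ x)) (ℤ.pos-* 2 (↧ₙ y)))

-- P is instantiated with "this gap is a peak" (see GapAt): a reflection of positive exponent
-- arises only as the middle child of a reflection, which is a peak, and carries that proof.
data Gap (P : Set) (x y : ℚ) : ℕ → Set where
  translation : ∀ {e} t → det ⟦ x ⟧ t ≡ 1ℤ →
                ⟦ y ⟧ ≡ ⟦ x ⟧ ⊕ + (3 ^ suc e) · t → Gap P x y (suc e)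
  reflection  : ∀ {e} t → det ⟦ x ⟧ t ≡ 1ℤ →
                ⟦ y ⟧ ≡ + (3 ^ e) · t ⊖ ⟦ x ⟧ → e ≡ 0 ⊎ P → Gap P x y e

det-gap : ∀ {P x y e} → Gap P x y e → det ⟦ x ⟧ ⟦ y ⟧ ≡ + (3 ^ e)
det-gap {x = x} (translation t unimodular hy)  = det-translation {⟦ x ⟧} {t} unimodular hy
det-gap {x = x} (reflection t unimodular hy _) = det-reflection {⟦ x ⟧} {t} unimodular hy

reflection′ : ∀ {P x y e} t {u} → ⟦ x ⟧ ≡ u → det u t ≡ 1ℤ →
              ⟦ y ⟧ ≡ + (3 ^ e) · t ⊖ u → e ≡ 0 ⊎ P → Gap P x y e
reflection′ t refl = reflection t

-- At exponent 0 the translate u + t is the reflection (2 u + t) - u.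
translation′ : ∀ {P x y} e t {u} → ⟦ x ⟧ ≡ u → det u t ≡ 1ℤ →
               ⟦ y ⟧ ≡ u ⊕ + (3 ^ e) · t → Gap P x y e
translation′ (suc e) t refl unimodular hy = translation t unimodular hy
translation′ zero t {u} refl unimodular hy =
  reflection (+ 2 · u ⊕ t) (trans (det-double u t) unimodular)
             (trans hy (as-reflection u t)) (inj₁ refl)
  where
  det-double : ∀ u t → det u (+ 2 · u ⊕ t) ≡ det u t
  det-double (p , q) (τ , σ) = identity p q τ σ
    where
    identity : ∀ p q τ σ →
      q ℤ.* (+ 2 ℤ.* p ℤ.+ τ) ℤ.- p ℤ.* (+ 2 ℤ.* q ℤ.+ σ) ≡ q ℤ.* τ ℤ.- p ℤ.* σ
    identity = solve-∀
  as-reflection : ∀ u t → u ⊕ + 1 · t ≡ + 1 · (+ 2 · u ⊕ t) ⊖ u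
  as-reflection (p , q) (τ , σ) = cong₂ _,_ (identity p τ) (identity q σ)
    where
    identity : ∀ p τ → p ℤ.+ + 1 ℤ.* τ ≡ + 1 ℤ.* (+ 2 ℤ.* p ℤ.+ τ) ℤ.- p
    identity = solve-∀

data Middle (P : Set) (x y : ℚ) (e : ℕ) : Set₁ where
  flat   : (∀ Q → Gap Q (med₁ x y) (med₂ x y) e) → Middle P x y e
  peaked : (∀ Q → Q → Gap Q (med₁ x y) (med₂ x y) (suc e)) →
           det ⟦ x ⟧ ⟦ y ⟧ ≡ + (3 ^ e) → e ≡ 0 ⊎ P → Middle P x y e

record Refinement (P : Set) (x y : ℚ) : Set₁ where
  field
    exponent : ℕ
    left     : ∀ Q → Gap Q x (med₁ x y) exponent
    middle   : Middle P x y exponent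
    right    : ∀ Q → Gap Q (med₂ x y) y exponent

refine-translation : ∀ {P x y} e t → det ⟦ x ⟧ t ≡ 1ℤ →
                     ⟦ y ⟧ ≡ ⟦ x ⟧ ⊕ + (3 ^ suc e) · t → Refinement P x y
refine-translation {x = x} {y} e t unimodular hy = record
  { exponent = e
  ; left     = λ _ → translation′ e t refl unimodular ⟦a⟧≡
  ; middle   = flat λ _ → translation′ e t ⟦a⟧≡ a-unimodular ⟦b⟧≡
  ; right    = λ _ → translation′ e t ⟦b⟧≡ b-unimodular ⟦y⟧≡
  }
  where
  u = ⟦ x ⟧
  c = + (3 ^ e)
  a = u ⊕ c · t
  b = a ⊕ c · t
  a-unimodular : det a t ≡ 1ℤ
  a-unimodular = translation-unimodular {u} unimodular {c = c} refl
  b-unimodular : det b t ≡ 1ℤ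
  b-unimodular = translation-unimodular {a} a-unimodular {c = c} refl
  ⟦y⟧≡′ : ⟦ y ⟧ ≡ u ⊕ (+ 3 ℤ.* c) · t
  ⟦y⟧≡′ = trans hy (cong (λ c′ → u ⊕ c′ · t) (ℤ.pos-* 3 (3 ^ e)))
  ⟦a⟧≡ : ⟦ med₁ x y ⟧ ≡ a
  ⟦a⟧≡ = ⟦med₁⟧≡ x y 3 a t (trans (cong (λ v → + 2 · u ⊕ v) ⟦y⟧≡′) (identity u t c)) a-unimodular
    where
    identity : ∀ u t c → + 2 · u ⊕ (u ⊕ (+ 3 ℤ.* c) · t) ≡ + 3 · (u ⊕ c · t)
    identity (p , q) (τ , σ) c = cong₂ _,_ (componentwise p τ c) (componentwise q σ c)
      where
      componentwise : ∀ p τ c → + 2 ℤ.* p ℤ.+ (p ℤ.+ + 3 ℤ.* c ℤ.* τ) ≡ + 3 ℤ.* (p ℤ.+ c ℤ.* τ)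
      componentwise = solve-∀
  ⟦b⟧≡ : ⟦ med₂ x y ⟧ ≡ b
  ⟦b⟧≡ = ⟦med₂⟧≡ x y 3 b t (trans (cong (λ v → u ⊕ + 2 · v) ⟦y⟧≡′) (identity u t c)) b-unimodular
    where
    identity : ∀ u t c → u ⊕ + 2 · (u ⊕ (+ 3 ℤ.* c) · t) ≡ + 3 · ((u ⊕ c · t) ⊕ c · t)
    identity (p , q) (τ , σ) c = cong₂ _,_ (componentwise p τ c) (componentwise q σ c)
      where
      componentwise : ∀ p τ c →
        p ℤ.+ + 2 ℤ.* (p ℤ.+ + 3 ℤ.* c ℤ.* τ) ≡ + 3 ℤ.* ((p ℤ.+ c ℤ.* τ) ℤ.+ c ℤ.* τ)
      componentwise = solve-∀
  ⟦y⟧≡ : ⟦ y ⟧ ≡ b ⊕ c · t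
  ⟦y⟧≡ = trans ⟦y⟧≡′ (identity u t c)
    where
    identity : ∀ u t c → u ⊕ (+ 3 ℤ.* c) · t ≡ ((u ⊕ c · t) ⊕ c · t) ⊕ c · t
    identity (p , q) (τ , σ) c = cong₂ _,_ (componentwise p τ c) (componentwise q σ c)
      where
      componentwise : ∀ p τ c → p ℤ.+ + 3 ℤ.* c ℤ.* τ ≡ ((p ℤ.+ c ℤ.* τ) ℤ.+ c ℤ.* τ) ℤ.+ c ℤ.* τ
      componentwise = solve-∀

refine-reflection : ∀ {P x y} e t → det ⟦ x ⟧ t ≡ 1ℤ →
                    ⟦ y ⟧ ≡ + (3 ^ e) · t ⊖ ⟦ x ⟧ → e ≡ 0 ⊎ P → Refinement P x y
refine-reflection {x = x} {y} e t unimodular hy peak = record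
  { exponent = e
  ; left     = λ _ → translation′ e t refl unimodular ⟦a⟧≡
  ; middle   = peaked (λ _ → reflection′ t ⟦a⟧≡ a-unimodular (trans ⟦b⟧≡ b≡) ∘ inj₂)
                      (det-reflection {u} {t} unimodular hy) peak
  ; right    = λ _ → translation′ e (⊝ t) ⟦b⟧≡ b-unimodular ⟦y⟧≡
  }
  where
  u = ⟦ x ⟧
  c = + (3 ^ e)
  a = u ⊕ c · t
  b = (+ 3 ℤ.* c) · t ⊖ a
  b≡ : b ≡ + (3 ^ suc e) · t ⊖ a
  b≡ = cong (λ c′ → c′ · t ⊖ a) (sym (ℤ.pos-* 3 (3 ^ e)))
  a-unimodular : det a t ≡ 1ℤ
  a-unimodular = translation-unimodular {u} unimodular {c = c} refl
  b-unimodular : det b (⊝ t) ≡ 1ℤ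
  b-unimodular = reflection-unimodular {a} a-unimodular {c = + 3 ℤ.* c} refl
  ⟦a⟧≡ : ⟦ med₁ x y ⟧ ≡ a
  ⟦a⟧≡ = ⟦med₁⟧≡ x y 1 a t (trans (cong (λ v → + 2 · u ⊕ v) hy) (identity u t c)) a-unimodular
    where
    identity : ∀ u t c → + 2 · u ⊕ (c · t ⊖ u) ≡ + 1 · (u ⊕ c · t)
    identity (p , q) (τ , σ) c = cong₂ _,_ (componentwise p τ c) (componentwise q σ c)
      where
      componentwise : ∀ p τ c → + 2 ℤ.* p ℤ.+ (c ℤ.* τ ℤ.- p) ≡ + 1 ℤ.* (p ℤ.+ c ℤ.* τ)
      componentwise = solve-∀
  ⟦b⟧≡ : ⟦ med₂ x y ⟧ ≡ b
  ⟦b⟧≡ = ⟦med₂⟧≡ x y 1 b (⊝ t) (trans (cong (λ v → u ⊕ + 2 · v) hy) (identity u t c)) b-unimodular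
    where
    identity : ∀ u t c → u ⊕ + 2 · (c · t ⊖ u) ≡ + 1 · ((+ 3 ℤ.* c) · t ⊖ (u ⊕ c · t))
    identity (p , q) (τ , σ) c = cong₂ _,_ (componentwise p τ c) (componentwise q σ c)
      where
      componentwise : ∀ p τ c →
        p ℤ.+ + 2 ℤ.* (c ℤ.* τ ℤ.- p) ≡ + 1 ℤ.* (+ 3 ℤ.* c ℤ.* τ ℤ.- (p ℤ.+ c ℤ.* τ))
      componentwise = solve-∀
  ⟦y⟧≡ : ⟦ y ⟧ ≡ b ⊕ c · ⊝ t
  ⟦y⟧≡ = trans hy (identity u t c)
    where
    identity : ∀ u t c → c · t ⊖ u ≡ ((+ 3 ℤ.* c) · t ⊖ (u ⊕ c · t)) ⊕ c · ⊝ t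
    identity (p , q) (τ , σ) c = cong₂ _,_ (componentwise p τ c) (componentwise q σ c)
      where
      componentwise : ∀ p τ c →
        c ℤ.* τ ℤ.- p ≡ (+ 3 ℤ.* c ℤ.* τ ℤ.- (p ℤ.+ c ℤ.* τ)) ℤ.+ c ℤ.* (ℤ.- τ)
      componentwise = solve-∀

refine : ∀ {P x y e} → Gap P x y e → Refinement P x y
refine (translation {e} t unimodular hy)    = refine-translation e t unimodular hy
refine (reflection {e} t unimodular hy peak) = refine-reflection e t unimodular hy peak

nth-step-head : ∀ x (l : List ℚ) → nth (step (x ∷ l)) 0 ≡ x
nth-step-head x []      = refl
nth-step-head x (_ ∷ _) = refl

nth-step : ∀ (l : List ℚ) j → suc j < length l →
  let x = nth l j ; y = nth l (suc j) in
  nth (step l) (j * 3) ≡ x × nth (step l) (1 + j * 3) ≡ med₁ x y ×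
  nth (step l) (2 + j * 3) ≡ med₂ x y × nth (step l) (3 + j * 3) ≡ y
nth-step (x ∷ y ∷ l) zero    _          = refl , refl , refl , nth-step-head y l
nth-step (x ∷ y ∷ l) (suc j) (s≤s j<∣l∣) = nth-step (y ∷ l) j j<∣l∣
nth-step (x ∷ [])    _       (s≤s ())

length-step : ∀ (l : List ℚ) {m} → length l ≡ suc m → length (step l) ≡ suc (m * 3)
length-step (x ∷ [])    refl = refl
length-step (x ∷ y ∷ l) refl = cong (λ n → 3 + n) (length-step (y ∷ l) refl)

length-SB : ∀ k → length (SB k) ≡ suc (3 ^ k)
length-SB zero    = refl
length-SB (suc k) = trans (length-step (SB k) (length-SB k)) (cong suc (ℕ.*-comm (3 ^ k) 3))

data Position : ℕ → Set where
  inLeft   : ∀ j → Position (j * 3)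
  inMiddle : ∀ j → Position (1 + j * 3)
  inRight  : ∀ j → Position (2 + j * 3)

position : ∀ i → Position i
position zero = inLeft 0
position (suc i) with position i
... | inLeft j   = inMiddle j
... | inMiddle j = inRight j
... | inRight j  = inLeft (suc j)

parent< : ∀ {k} r j → r + j * 3 < 3 ^ suc k → j < 3 ^ k
parent< {k} r j r+j*3< = ℕ.*-cancelˡ-< 3 j (3 ^ k)
  (subst (_< 3 ^ suc k) (ℕ.*-comm j 3) (ℕ.≤-<-trans (ℕ.m≤n+m (j * 3) r) r+j*3<))

last-child< : ∀ {k j} → j < 3 ^ k → 2 + j * 3 < 3 ^ suc k
last-child< {k} {j} j< = subst (3 + j * 3 ≤_) (ℕ.*-comm (3 ^ k) 3) (ℕ.*-monoˡ-≤ 3 j<)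

3^n<3^1+n : ∀ n → + (3 ^ n) ℤ.< + (3 ^ suc n)
3^n<3^1+n n = ℤ.+<+ (ℕ.^-monoʳ-< 3 (s≤s (s≤s z≤n)) (ℕ.n<1+n n))

GapAt : ℕ → ℕ → ℕ → Set
GapAt k j e = Gap (IsPeak k j) (nth (SB k) j) (nth (SB k) (suc j)) e

Gaps : ℕ → Set
Gaps k = ∀ j → j < 3 ^ k → ∃[ e ] GapAt k j e

gapAt : ∀ {k i u v e} → nth (SB k) i ≡ u → nth (SB k) (suc i) ≡ v →
        Gap (IsPeak k i) u v e → GapAt k i e
gapAt refl refl g = g

PeakParent : ℕ → ℕ → Set
PeakParent k i = ∃[ j ] ∃[ e ]
  (i ≡ 1 + j * 3 × C (suc k) i ≡ + (3 ^ suc e) × C k j ≡ + (3 ^ e) × (e ≡ 0 ⊎ IsPeak k j))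

-- r + j * 3 is any child of the gap j; it only serves to bound j.
module Refined (k : ℕ) (gaps-k : Gaps k) (r j : ℕ) (child< : r + j * 3 < 3 ^ suc k) where

  j<3^k : j < 3 ^ k
  j<3^k = parent< {k} r j child<

  x y a b : ℚ
  x = nth (SB k) j
  y = nth (SB k) (suc j)
  a = med₁ x y
  b = med₂ x y

  open Refinement (refine (proj₂ (gaps-k j j<3^k))) public

  private
    nth-children : nth (SB (suc k)) (j * 3) ≡ x × nth (SB (suc k)) (1 + j * 3) ≡ a ×
                   nth (SB (suc k)) (2 + j * 3) ≡ b × nth (SB (suc k)) (3 + j * 3) ≡ y
    nth-children = nth-step (SB k) j (subst (suc j <_) (sym (length-SB k)) (s≤s j<3^k))

  ≡x : nth (SB (suc k)) (j * 3) ≡ x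
  ≡x = proj₁ nth-children
  ≡a : nth (SB (suc k)) (1 + j * 3) ≡ a
  ≡a = proj₁ (proj₂ nth-children)
  ≡b : nth (SB (suc k)) (2 + j * 3) ≡ b
  ≡b = proj₁ (proj₂ (proj₂ nth-children))
  ≡y : nth (SB (suc k)) (3 + j * 3) ≡ y
  ≡y = proj₂ (proj₂ (proj₂ nth-children))

  middle< : 1 + j * 3 < 3 ^ suc k
  middle< = ℕ.<-trans (ℕ.n<1+n _) (last-child< {k} j<3^k)
  left< : j * 3 < 3 ^ suc k
  left< = ℕ.<-trans (ℕ.n<1+n _) middle<

  C-left : C (suc k) (j * 3) ≡ + (3 ^ exponent)
  C-left = trans (cong₂ (λ u v → det ⟦ u ⟧ ⟦ v ⟧) ≡x ≡a) (det-gap (left ⊤))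
  C-middle : C (suc k) (1 + j * 3) ≡ det ⟦ a ⟧ ⟦ b ⟧
  C-middle = cong₂ (λ u v → det ⟦ u ⟧ ⟦ v ⟧) ≡a ≡b
  C-right : C (suc k) (2 + j * 3) ≡ + (3 ^ exponent)
  C-right = trans (cong₂ (λ u v → det ⟦ u ⟧ ⟦ v ⟧) ≡b ≡y) (det-gap (right ⊤))

  3^exponent≤C-middle : + (3 ^ exponent) ℤ.≤ C (suc k) (1 + j * 3)
  3^exponent≤C-middle with middle
  ... | flat gap       = ℤ.≤-reflexive (sym (trans C-middle (det-gap (gap ⊤))))
  ... | peaked gap _ _ = ℤ.<⇒≤ (subst (+ (3 ^ exponent) ℤ.<_)
                                      (sym (trans C-middle (det-gap (gap ⊤ tt))))
                                      (3^n<3^1+n exponent))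

  left≤middle : C (suc k) (j * 3) ℤ.≤ C (suc k) (1 + j * 3)
  left≤middle = subst (ℤ._≤ C (suc k) (1 + j * 3)) (sym C-left) 3^exponent≤C-middle
  right≤middle : C (suc k) (2 + j * 3) ℤ.≤ C (suc k) (1 + j * 3)
  right≤middle = subst (ℤ._≤ C (suc k) (1 + j * 3)) (sym C-right) 3^exponent≤C-middle

  left-gap : ∃[ e ] GapAt (suc k) (j * 3) e
  left-gap = _ , gapAt {suc k} ≡x ≡a (left _)
  right-gap : ∃[ e ] GapAt (suc k) (2 + j * 3) e
  right-gap = _ , gapAt {suc k} ≡b ≡y (right _)

  middle-gap : ∃[ e ] GapAt (suc k) (1 + j * 3) e
  middle-gap with middle
  ... | flat gap       = _ , gapAt {suc k} ≡a ≡b (gap _)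
  ... | peaked gap _ _ = _ , gapAt {suc k} ≡a ≡b (gap _ (middle< , dominates))
    where
    C-middle≡ : C (suc k) (1 + j * 3) ≡ + (3 ^ suc exponent)
    C-middle≡ = trans C-middle (det-gap (gap ⊤ tt))
    dominates : ∀ i → i < 3 ^ suc k → suc i ≡ 1 + j * 3 ⊎ i ≡ 2 + j * 3 →
                C (suc k) i ℤ.< C (suc k) (1 + j * 3)
    dominates _ _ (inj₁ refl) = subst₂ ℤ._<_ (sym C-left) (sym C-middle≡) (3^n<3^1+n exponent)
    dominates _ _ (inj₂ refl) = subst₂ ℤ._<_ (sym C-right) (sym C-middle≡) (3^n<3^1+n exponent)

  middle-peakParent : C (suc k) (j * 3) ℤ.< C (suc k) (1 + j * 3) → PeakParent k (1 + j * 3)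
  middle-peakParent left<middle with middle
  ... | flat gap =
    ⊥-elim (ℤ.<-irrefl (trans C-left (sym (trans C-middle (det-gap (gap ⊤))))) left<middle)
  ... | peaked gap x-y peak =
    j , exponent , refl , trans C-middle (det-gap (gap ⊤ tt)) , x-y , peak

gaps : ∀ k → Gaps k
gaps zero    zero    _        = 0 , reflection (+ 1 , + 2) refl refl (inj₁ refl)
gaps zero    (suc j) (s≤s ())
gaps (suc k) i       i<3^1+k with position i
... | inLeft j   = Refined.left-gap   k (gaps k) 0 j i<3^1+k
... | inMiddle j = Refined.middle-gap k (gaps k) 1 j i<3^1+k
... | inRight j  = Refined.right-gap  k (gaps k) 2 j i<3^1+k

peak-parent : ∀ k i → IsPeak (suc k) i → PeakParent k i
peak-parent k i (i<3^1+k , dominates) with position i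
... | inLeft j = ⊥-elim (ℤ.<⇒≱ (dominates (1 + j * 3) middle< (inj₂ refl)) left≤middle)
  where open Refined k (gaps k) 0 j i<3^1+k
... | inMiddle j = middle-peakParent (dominates (j * 3) left< (inj₁ refl))
  where open Refined k (gaps k) 1 j i<3^1+k
... | inRight j = ⊥-elim (ℤ.<⇒≱ (dominates (1 + j * 3) middle< (inj₁ refl)) right≤middle)
  where open Refined k (gaps k) 2 j i<3^1+k

lemma22 : (n : ℕ) → 1 ≤ n →
    ((m i : ℕ) → 2 ≤ m → C n i ≡ + (3 ^ m) → IsPeak n i →
      ∃[ j ] (i ≡ 3 * j + 1 × C (n ∸ 1) j ≡ + (3 ^ (m ∸ 1)) × IsPeak (n ∸ 1) j))
    × ((i : ℕ) → C n i ≡ + 3 → IsPeak n i →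
      ∃[ j ] (i ≡ 3 * j + 1 × C (n ∸ 1) j ≡ + 1))
lemma22 (suc k) _ = peak-3^m , peak-3
  where
  index : ∀ {i} j → i ≡ 1 + j * 3 → i ≡ 3 * j + 1
  index j refl = trans (ℕ.+-comm 1 (j * 3)) (cong (_+ 1) (ℕ.*-comm j 3))

  cancel-3 : ∀ {c} e m → c ≡ + (3 ^ suc e) → c ≡ + (3 * m) → 3 ^ e ≡ m
  cancel-3 e m c≡3^1+e c≡3m = ℕ.*-cancelˡ-≡ (3 ^ e) m 3 (ℤ.+-injective (trans (sym c≡3^1+e) c≡3m))

  peak-3^m : (m i : ℕ) → 2 ≤ m → C (suc k) i ≡ + (3 ^ m) → IsPeak (suc k) i →
             ∃[ j ] (i ≡ 3 * j + 1 × C k j ≡ + (3 ^ (m ∸ 1)) × IsPeak k j)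
  peak-3^m (suc zero)    _ (s≤s ())
  peak-3^m (suc (suc m)) i _ C≡3^m isPeak with peak-parent k i isPeak
  ... | j , e , i≡ , C≡3^1+e , Cj≡3^e , e≡0⊎peak =
    j , index j i≡ , trans Cj≡3^e (cong +_ 3^e≡3^m) , parent-peak e≡0⊎peak
    where
    3^e≡3^m : 3 ^ e ≡ 3 ^ suc m
    3^e≡3^m = cancel-3 e (3 ^ suc m) C≡3^1+e C≡3^m
    parent-peak : e ≡ 0 ⊎ IsPeak k j → IsPeak k j
    parent-peak (inj₂ peak) = peak
    parent-peak (inj₁ refl) with ℕ.m*n≡1⇒m≡1 3 (3 ^ m) (sym 3^e≡3^m)
    ... | ()

  peak-3 : (i : ℕ) → C (suc k) i ≡ + 3 → IsPeak (suc k) i → ∃[ j ] (i ≡ 3 * j + 1 × C k j ≡ + 1)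
  peak-3 i C≡3 isPeak with peak-parent k i isPeak
  ... | j , e , i≡ , C≡3^1+e , Cj≡3^e , _ =
    j , index j i≡ , trans Cj≡3^e (cong +_ (cancel-3 e 1 C≡3^1+e C≡3))
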